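{- Let $G$ be a thick spider with spider partition $(S,K,R)$ where $|S|=|K|\ge3$, and let $e$ be a non-edge of $G$ with one endpoint in $S$ and the other in $K$. Then the ($P_4$-sparse,$+1$)-MinEdgeAddition Problem for $G$ and $e$ admits an optimal solution whose only fill edge is $e$.
   Context: All graphs are finite, simple, undirected. A graph is $P_4$-sparse if no five vertices induce more than one $P_4$. A thick spider is a graph whose vertex set has a partition $(S,K,R)$ with $S$ independent, $K$ a clique, $|S|=|K|$, every vertex of $R$ adjacent to all of $K$ and none of $S$, and a bijection $f:S\to K$ with $N(s)\cap K=K\setminus\{f(s)\}$ for every $s\in S$. ($P_4$-sparse,$+1$)-MinEdgeAddition Problem: for a $P_4$-sparse graph $G$ and a non-edge $e$, a solution is a $P_4$-sparse graph $H$ with $V(H)=V(G)$ and $E(G)\cup\{e\}\subseteq E(H)$; fill edges are the edges of $E(H)\setminus E(G)$ (including $e$); an optimal solution minimizes their number. -}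

module Defs where

open import Data.Nat using (ℕ; _≤_; _<_)
open import Data.Bool using (Bool; true; false; _∧_; not; if_then_else_)
open import Data.Fin using (Fin; toℕ)
open import Data.Fin.Subset using (Subset; ⁅_⁆; _∪_; ∣_∣; _∈_)
open import Data.List using (List; map; allFin)
open import Data.Nat.ListAction using (sum)
open import Data.Vec using (tabulate)
open import Data.Product using (Σ; ∃; _×_; _,_)
open import Data.Sum using (_⊎_)
open import Relation.Binary.PropositionalEquality using (_≡_; _≢_)
open import Relation.Nullary using (¬_; does)
open import Data.Nat using (_<?_)

record Graph (n : ℕ) : Set where
  field
    adj    : Fin n → Fin n → Bool
    sym    : ∀ x y → adj x y ≡ adj y x
    irrefl : ∀ x → adj x x ≡ false
open Graph public

Edge : ∀ {n} → Graph n → Fin n → Fin n → Set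
Edge G x y = adj G x y ≡ true

InducedP4 : ∀ {n} → Graph n → Fin n → Fin n → Fin n → Fin n → Set
InducedP4 G a b c d =
  (a ≢ b × a ≢ c × a ≢ d × b ≢ c × b ≢ d × c ≢ d) ×
  (Edge G a b × Edge G b c × Edge G c d) ×
  (¬ Edge G a c × ¬ Edge G b d × ¬ Edge G a d)

IsP4Set : ∀ {n} → Graph n → Subset n → Set
IsP4Set G X = Σ _ λ a → Σ _ λ b → Σ _ λ c → Σ _ λ d →
  InducedP4 G a b c d × X ≡ ⁅ a ⁆ ∪ ⁅ b ⁆ ∪ ⁅ c ⁆ ∪ ⁅ d ⁆

-- P4-sparse: no five vertices induce more than one P4, i.e. any two
-- P4-inducing vertex sets contained in a common set of at most five
-- vertices coincide.
P4Sparse : ∀ {n} → Graph n → Set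
P4Sparse G = ∀ X Y → IsP4Set G X → IsP4Set G Y → ∣ X ∪ Y ∣ ≤ 5 → X ≡ Y

data Part : Set where
  inS inK inR : Part

isS isK : Part → Bool
isS inS = true
isS _   = false
isK inK = true
isK _   = false

-- Thick spider structure on G: partition (S,K,R) given by `part`,
-- bijection f : S → K given by `f` (restricted to S).
record ThickSpider {n : ℕ} (G : Graph n) : Set where
  field
    part : Fin n → Part
    f    : Fin n → Fin n
  S : Subset n
  S = tabulate (λ v → isS (part v))
  K : Subset n
  K = tabulate (λ v → isK (part v))
  field
    S-indep   : ∀ x y → part x ≡ inS → part y ≡ inS → ¬ Edge G x y
    K-clique  : ∀ x y → part x ≡ inK → part y ≡ inK → x ≢ y → Edge G x y
    |S|≡|K|   : ∣ S ∣ ≡ ∣ K ∣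
    R-K       : ∀ r k → part r ≡ inR → part k ≡ inK → Edge G r k
    R-S       : ∀ r s → part r ≡ inR → part s ≡ inS → ¬ Edge G r s
    f-into    : ∀ s → part s ≡ inS → part (f s) ≡ inK
    f-inj     : ∀ s s′ → part s ≡ inS → part s′ ≡ inS → f s ≡ f s′ → s ≡ s′
    f-onto    : ∀ k → part k ≡ inK → ∃ λ s → part s ≡ inS × f s ≡ k
    S-K       : ∀ s k → part s ≡ inS → part k ≡ inK →
                  (Edge G s k → k ≢ f s) × (k ≢ f s → Edge G s k)
open ThickSpider public

Solution : ∀ {n} → Graph n → Fin n → Fin n → Graph n → Set
Solution G u v H = P4Sparse H × Edge H u v × (∀ x y → Edge G x y → Edge H x y)

-- number of fill edges E(H) \ E(G) (unordered pairs counted once)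
fillCount : ∀ {n} → Graph n → Graph n → ℕ
fillCount {n} G H = sum (map (λ x → sum (map (λ y →
  if does (toℕ x <? toℕ y) ∧ adj H x y ∧ not (adj G x y) then 1 else 0)
  (allFin n))) (allFin n))

OptimalSolution : ∀ {n} → Graph n → Fin n → Fin n → Graph n → Set
OptimalSolution G u v H =
  Solution G u v H × (∀ H′ → Solution G u v H′ → fillCount G H ≤ fillCount G H′)

OnlyFillEdge : ∀ {n} → Graph n → Fin n → Fin n → Graph n → Set
OnlyFillEdge G u v H = ∀ x y → Edge H x y → ¬ Edge G x y →
  (x ≡ u × y ≡ v) ⊎ (x ≡ v × y ≡ u)

{-# OPTIONS --safe #-}
-- In a thick spider the non-edge e = uv with u ∈ S, v ∈ K forces v = f(u), and f(u) is
-- adjacent to every vertex except u. So G + e is G with v made universal. A universal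
-- vertex lies on no induced P4, hence every induced P4 of G + e is one of G and G + e is
-- P4-sparse; it is optimal because every solution has e as a fill edge.
module Submission where

open import Defs hiding (sym)
open import Data.Nat using (ℕ; _≤_; _<_; zero; suc; _<?_; _<ᵇ_; z≤n)
open import Data.Nat.Properties
  using (≤-refl; ≤-trans; ≤-reflexive; m≤m+n; m≤n+m; +-identityʳ; <ᵇ⇒<; <-cmp; <-asym; <-irrefl; module ≤-Reasoning)
open import Data.Fin using (Fin; toℕ) renaming (zero to fzero; suc to fsuc)
open import Data.Fin.Properties using (_≟_; suc-injective; toℕ-injective)
open import Data.Fin.Subset using (∣_∣)
open import Data.Bool using (Bool; true; false; _∧_; not; if_then_else_; T)
open import Data.Bool.Properties using (¬-not)
open import Data.List using (map; allFin; tabulate)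
open import Data.List.Properties using (map-tabulate)
open import Data.Nat.ListAction using (sum)
open import Data.Product using (∃; _×_; _,_; proj₁; proj₂)
open import Data.Sum using (_⊎_; inj₁; inj₂)
open import Data.Empty using (⊥-elim)
open import Data.Unit using (tt)
open import Function using (id; _∘_)
open import Relation.Binary.PropositionalEquality
  using (_≡_; _≢_; refl; sym; trans; cong; subst)
open import Relation.Binary.Definitions using (tri<; tri≈; tri>)
open import Relation.Nullary using (¬_; yes; no; does)
open import Relation.Nullary.Decidable using (dec-true)

sum-tabulate-zero : ∀ {n} (g : Fin n → ℕ) → (∀ x → g x ≡ 0) → sum (tabulate g) ≡ 0
sum-tabulate-zero {zero}  g g≡0 = refl
sum-tabulate-zero {suc n} g g≡0
  rewrite g≡0 fzero = sum-tabulate-zero (λ x → g (fsuc x)) (λ x → g≡0 (fsuc x))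

sum-tabulate-single : ∀ {n} (g : Fin n → ℕ) (a : Fin n) →
  (∀ x → x ≢ a → g x ≡ 0) → sum (tabulate g) ≡ g a
sum-tabulate-single g fzero g≡0
  rewrite sum-tabulate-zero (λ x → g (fsuc x)) (λ x → g≡0 (fsuc x) (λ ()))
  = +-identityʳ (g fzero)
sum-tabulate-single g (fsuc a) g≡0
  rewrite g≡0 fzero (λ ())
  = sum-tabulate-single (λ x → g (fsuc x)) a (λ x x≢a → g≡0 (fsuc x) (λ eq → x≢a (suc-injective eq)))

≤-sum-tabulate : ∀ {n} (g : Fin n → ℕ) (a : Fin n) → g a ≤ sum (tabulate g)
≤-sum-tabulate g fzero    = m≤m+n (g fzero) _
≤-sum-tabulate g (fsuc a) = ≤-trans (≤-sum-tabulate (λ x → g (fsuc x)) a) (m≤n+m _ (g fzero))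

sum-map-allFin : ∀ {n} (g : Fin n → ℕ) → sum (map g (allFin n)) ≡ sum (tabulate g)
sum-map-allFin g = cong sum (map-tabulate id g)

sum-allFin-zero : ∀ {n} (g : Fin n → ℕ) → (∀ x → g x ≡ 0) → sum (map g (allFin n)) ≡ 0
sum-allFin-zero g g≡0 = trans (sum-map-allFin g) (sum-tabulate-zero g g≡0)

sum-allFin-single : ∀ {n} (g : Fin n → ℕ) (a : Fin n) →
  (∀ x → x ≢ a → g x ≡ 0) → sum (map g (allFin n)) ≡ g a
sum-allFin-single g a g≡0 = trans (sum-map-allFin g) (sum-tabulate-single g a g≡0)

≤-sum-allFin : ∀ {n} (g : Fin n → ℕ) (a : Fin n) → g a ≤ sum (map g (allFin n))
≤-sum-allFin g a = ≤-trans (≤-sum-tabulate g a) (≤-reflexive (sym (sum-map-allFin g)))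

Edge-sym : ∀ {n} (G : Graph n) {x y} → Edge G x y → Edge G y x
Edge-sym G {x} {y} e = trans (Graph.sym G y x) e

Edge-irrefl : ∀ {n} (G : Graph n) {x} → ¬ Edge G x x
Edge-irrefl G {x} e with trans (sym e) (irrefl G x)
... | ()

Universal : ∀ {n} → Graph n → Fin n → Set
Universal G w = ∀ x → x ≢ w → Edge G w x

module _ {n} (G H : Graph n) where

  -- Each unordered pair is counted by fillCount at the ordering with toℕ x < toℕ y.
  CountedFill : Fin n → Fin n → Set
  CountedFill x y = toℕ x < toℕ y × Edge H x y × ¬ Edge G x y

  fillTerm : Fin n → Fin n → ℕ
  fillTerm x y = if does (toℕ x <? toℕ y) ∧ adj H x y ∧ not (adj G x y) then 1 else 0

  fillTerm≤1 : ∀ x y → fillTerm x y ≤ 1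
  fillTerm≤1 x y with does (toℕ x <? toℕ y) ∧ adj H x y ∧ not (adj G x y)
  ... | true  = ≤-refl
  ... | false = z≤n

  CountedFill⇒fillTerm≡1 : ∀ {x y} → CountedFill x y → fillTerm x y ≡ 1
  CountedFill⇒fillTerm≡1 {x} {y} (x<y , e , ¬e)
    rewrite dec-true (toℕ x <? toℕ y) x<y | e | ¬-not ¬e = refl

  fillTerm≡0⊎CountedFill : ∀ x y → fillTerm x y ≡ 0 ⊎ CountedFill x y
  fillTerm≡0⊎CountedFill x y with toℕ x <ᵇ toℕ y in x<ᵇy | adj H x y | adj G x y
  ... | true  | true  | false = inj₂ (<ᵇ⇒< (toℕ x) (toℕ y) (subst T (sym x<ᵇy) tt) , refl , λ ())
  ... | true  | true  | true  = inj₁ refl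
  ... | true  | false | _     = inj₁ refl
  ... | false | _     | _     = inj₁ refl

  fillRow : Fin n → ℕ
  fillRow x = sum (map (fillTerm x) (allFin n))

  fillCount≤1 : ∀ a b → (∀ {x y} → CountedFill x y → x ≡ a × y ≡ b) → fillCount G H ≤ 1
  fillCount≤1 a b pinned = begin
    fillCount G H  ≡⟨ sum-allFin-single fillRow a other-row-zero ⟩
    fillRow a      ≡⟨ sum-allFin-single (fillTerm a) b (λ y y≢b → outside (y≢b ∘ proj₂)) ⟩
    fillTerm a b   ≤⟨ fillTerm≤1 a b ⟩
    1              ∎
    where
      open ≤-Reasoning
      outside : ∀ {x y} → ¬ (x ≡ a × y ≡ b) → fillTerm x y ≡ 0
      outside {x} {y} ¬xy with fillTerm≡0⊎CountedFill x y
      ... | inj₁ t≡0  = t≡0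
      ... | inj₂ fill = ⊥-elim (¬xy (pinned fill))
      other-row-zero : ∀ x → x ≢ a → fillRow x ≡ 0
      other-row-zero x x≢a = sum-allFin-zero (fillTerm x) (λ y → outside {x} {y} (x≢a ∘ proj₁))

  CountedFill⇒1≤fillCount : ∀ {x y} → CountedFill x y → 1 ≤ fillCount G H
  CountedFill⇒1≤fillCount {x} {y} fill = begin
    1              ≡⟨ sym (CountedFill⇒fillTerm≡1 fill) ⟩
    fillTerm x y   ≤⟨ ≤-sum-allFin (fillTerm x) y ⟩
    fillRow x      ≤⟨ ≤-sum-allFin fillRow x ⟩
    fillCount G H  ∎
    where open ≤-Reasoning

  1≤fillCount : ∀ {u v} → Edge H u v → ¬ Edge G u v → 1 ≤ fillCount G H
  1≤fillCount {u} {v} e ¬e with <-cmp (toℕ u) (toℕ v)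
  ... | tri< u<v _ _ = CountedFill⇒1≤fillCount (u<v , e , ¬e)
  ... | tri≈ _ u≡v _ = ⊥-elim (Edge-irrefl H (subst (Edge H u) (sym (toℕ-injective u≡v)) e))
  ... | tri> _ _ v<u = CountedFill⇒1≤fillCount (v<u , Edge-sym H e , ¬e ∘ Edge-sym G)

  OnlyFillEdge⇒fillCount≤1 : ∀ {u v} → OnlyFillEdge G u v H → fillCount G H ≤ 1
  OnlyFillEdge⇒fillCount≤1 {u} {v} only with <-cmp (toℕ u) (toℕ v)
  ... | tri< u<v _ _ = fillCount≤1 u v pinned
    where
      pinned : ∀ {x y} → CountedFill x y → x ≡ u × y ≡ v
      pinned {x} {y} (x<y , e , ¬e) with only x y e ¬e
      ... | inj₁ xy          = xy
      ... | inj₂ (refl , refl) = ⊥-elim (<-asym x<y u<v)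
  ... | tri≈ _ u≡v _ = fillCount≤1 u v pinned
    where
      pinned : ∀ {x y} → CountedFill x y → x ≡ u × y ≡ v
      pinned {x} {y} (x<y , e , ¬e) with only x y e ¬e
      ... | inj₁ (refl , refl) = ⊥-elim (<-irrefl u≡v x<y)
      ... | inj₂ (refl , refl) = ⊥-elim (<-irrefl (sym u≡v) x<y)
  ... | tri> _ _ v<u = fillCount≤1 v u pinned
    where
      pinned : ∀ {x y} → CountedFill x y → x ≡ v × y ≡ u
      pinned {x} {y} (x<y , e , ¬e) with only x y e ¬e
      ... | inj₁ (refl , refl) = ⊥-elim (<-asym x<y v<u)
      ... | inj₂ xy          = xy

OnlyFillEdge⇒OptimalSolution : ∀ {n} (G H : Graph n) (u v : Fin n) → ¬ Edge G u v →
  Solution G u v H → OnlyFillEdge G u v H → OptimalSolution G u v H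
OnlyFillEdge⇒OptimalSolution G H u v ¬e sol only = sol , λ { H′ (_ , e , _) →
  ≤-trans (OnlyFillEdge⇒fillCount≤1 G H only) (1≤fillCount G H′ e ¬e) }

module _ {n} (G : Graph n) (v : Fin n) where

  private
    adjᵛ : Fin n → Fin n → Bool
    adjᵛ x y with x ≟ v | y ≟ v
    ... | yes _ | yes _ = false
    ... | yes _ | no _  = true
    ... | no _  | yes _ = true
    ... | no _  | no _  = adj G x y

    adjᵛ-sym : ∀ x y → adjᵛ x y ≡ adjᵛ y x
    adjᵛ-sym x y with x ≟ v | y ≟ v
    ... | yes _ | yes _ = refl
    ... | yes _ | no _  = refl
    ... | no _  | yes _ = refl
    ... | no _  | no _  = Graph.sym G x y

    adjᵛ-irrefl : ∀ x → adjᵛ x x ≡ false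
    adjᵛ-irrefl x with x ≟ v
    ... | yes _ = refl
    ... | no _  = irrefl G x

  withUniversal : Graph n
  withUniversal = record { adj = adjᵛ ; sym = adjᵛ-sym ; irrefl = adjᵛ-irrefl }

  withUniversal-universal : Universal withUniversal v
  withUniversal-universal x x≢v with v ≟ v | x ≟ v
  ... | no v≢v | _     = ⊥-elim (v≢v refl)
  ... | yes _  | yes p = ⊥-elim (x≢v p)
  ... | yes _  | no _  = refl

  withUniversal-off : ∀ {x y} → x ≢ v → y ≢ v → adj withUniversal x y ≡ adj G x y
  withUniversal-off {x} {y} x≢v y≢v with x ≟ v | y ≟ v
  ... | yes p | _     = ⊥-elim (x≢v p)
  ... | no _  | yes p = ⊥-elim (y≢v p)
  ... | no _  | no _  = refl

  ⊆-withUniversal : ∀ x y → Edge G x y → Edge withUniversal x y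
  ⊆-withUniversal x y e with x ≟ v | y ≟ v
  ... | yes refl | yes refl = ⊥-elim (Edge-irrefl G e)
  ... | yes _    | no _     = refl
  ... | no _     | yes _    = refl
  ... | no _     | no _     = e

non-neighbour-≢-universal : ∀ {n} (K : Graph n) {w x y} → Universal K w →
  x ≢ y → ¬ Edge K x y → x ≢ w
non-neighbour-≢-universal K universal x≢y ¬e refl = ¬e (universal _ (λ y≡x → x≢y (sym y≡x)))

universal-∉-InducedP4 : ∀ {n} (K : Graph n) {w a b c d} → Universal K w →
  InducedP4 K a b c d → a ≢ w × b ≢ w × c ≢ w × d ≢ w
universal-∉-InducedP4 K universal ((a≢b , a≢c , a≢d , b≢c , b≢d , c≢d) , _ , (a≁c , b≁d , a≁d)) =
  non-neighbour-≢-universal K universal a≢c a≁c ,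
  non-neighbour-≢-universal K universal b≢d b≁d ,
  non-neighbour-≢-universal K universal (a≢c ∘ sym) (a≁c ∘ Edge-sym K) ,
  non-neighbour-≢-universal K universal (b≢d ∘ sym) (b≁d ∘ Edge-sym K)

module _ {n} (G : Graph n) (v : Fin n) where

  private
    H = withUniversal G v

  InducedP4-withUniversal : ∀ {a b c d} → InducedP4 H a b c d → InducedP4 G a b c d
  InducedP4-withUniversal p@(distinct , (ab , bc , cd) , (a≁c , b≁d , a≁d))
    with universal-∉-InducedP4 H (withUniversal-universal G v) p
  ... | a≢v , b≢v , c≢v , d≢v =
    distinct ,
    (edge a≢v b≢v ab , edge b≢v c≢v bc , edge c≢v d≢v cd) ,
    (non-edge a≢v c≢v a≁c , non-edge b≢v d≢v b≁d , non-edge a≢v d≢v a≁d)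
    where
      edge : ∀ {x y} → x ≢ v → y ≢ v → Edge H x y → Edge G x y
      edge x≢v y≢v e = trans (sym (withUniversal-off G v x≢v y≢v)) e
      non-edge : ∀ {x y} → x ≢ v → y ≢ v → ¬ Edge H x y → ¬ Edge G x y
      non-edge x≢v y≢v ¬e e = ¬e (trans (withUniversal-off G v x≢v y≢v) e)

  P4Sparse-withUniversal : P4Sparse G → P4Sparse H
  P4Sparse-withUniversal sparse X Y (a , b , c , d , p , X≡) (a′ , b′ , c′ , d′ , p′ , Y≡) =
    sparse X Y (a , b , c , d , InducedP4-withUniversal p , X≡)
               (a′ , b′ , c′ , d′ , InducedP4-withUniversal p′ , Y≡)

  withUniversal-OnlyFillEdge : ∀ {u} → (∀ x → x ≢ v → x ≢ u → Edge G v x) → OnlyFillEdge G u v H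
  withUniversal-OnlyFillEdge {u} near-universal x y e ¬e with v ≟ x | v ≟ y
  ... | yes refl | yes refl = ⊥-elim (Edge-irrefl H {x} e)
  ... | no v≢x   | no v≢y   = ⊥-elim (¬e (trans (sym (withUniversal-off G v (v≢x ∘ sym) (v≢y ∘ sym))) e))
  ... | yes refl | no v≢y with y ≟ u
  ...   | yes y≡u = inj₂ (refl , y≡u)
  ...   | no y≢u  = ⊥-elim (¬e (near-universal y (v≢y ∘ sym) y≢u))
  withUniversal-OnlyFillEdge {u} near-universal x y e ¬e
      | no v≢x | yes refl with x ≟ u
  ...   | yes x≡u = inj₁ (x≡u , refl)
  ...   | no x≢u  = ⊥-elim (¬e (Edge-sym G (near-universal x (v≢x ∘ sym) x≢u)))

module _ {n} {G : Graph n} (T : ThickSpider G) where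

  f-adjacent : ∀ {s} → part T s ≡ inS → ∀ x → x ≢ f T s → x ≢ s → Edge G (f T s) x
  f-adjacent {s} s∈S x x≢fs x≢s with part T x in x∈
  ... | inS = Edge-sym G (proj₂ (S-K T x (f T s) x∈ (f-into T s s∈S)) (x≢s ∘ f-inj T x s x∈ s∈S ∘ sym))
  ... | inK = K-clique T (f T s) x (f-into T s s∈S) x∈ (x≢fs ∘ sym)
  ... | inR = Edge-sym G (R-K T x (f T s) x∈ (f-into T s s∈S))

  non-edge⇒≡f : ∀ {s k} → part T s ≡ inS → part T k ≡ inK → ¬ Edge G s k → k ≡ f T s
  non-edge⇒≡f {s} {k} s∈S k∈K s≁k with k ≟ f T s
  ... | yes k≡fs = k≡fs
  ... | no k≢fs  = ⊥-elim (s≁k (proj₂ (S-K T s k s∈S k∈K) k≢fs))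

lemma14 : ∀ {n} (G : Graph n) (T : ThickSpider G) →
    3 ≤ ∣ S T ∣ →
    P4Sparse G →
    (u v : Fin n) → part T u ≡ inS → part T v ≡ inK → ¬ Edge G u v →
    ∃ λ H → OptimalSolution G u v H × OnlyFillEdge G u v H
lemma14 G T _ sparse u v u∈S v∈K u≁v =
  withUniversal G v , OnlyFillEdge⇒OptimalSolution G (withUniversal G v) u v u≁v solution only , only
  where
    v-near-universal : ∀ x → x ≢ v → x ≢ u → Edge G v x
    v-near-universal x x≢v rewrite non-edge⇒≡f T u∈S v∈K u≁v = f-adjacent T u∈S x x≢v

    only : OnlyFillEdge G u v (withUniversal G v)
    only = withUniversal-OnlyFillEdge G v v-near-universal

    u≢v : u ≢ v
    u≢v refl with trans (sym u∈S) v∈K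
    ... | ()

    solution : Solution G u v (withUniversal G v)
    solution = P4Sparse-withUniversal G v sparse ,
               Edge-sym (withUniversal G v) {v} {u} (withUniversal-universal G v u u≢v) ,
               ⊆-withUniversal G v
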